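{- Let $f(x,a)$ be a polynomial in $x$ and $a$ (with rational coefficients). Then for every integer $k>1$ there exists a polynomial $P_{f,k}(x)$, divisible by $x$, such that $$P_{f,k}(n)=\sum_{a=0}^{n-1}f(n,a)\cdot\Big(\sum_{j=0}^{k-1}\ \sum_{\substack{ -a\le i_1<\cdots<i_j\le-1\\1\le i'_1<\cdots<i'_{k-1-j}\le n-1-a}}\frac{1}{i_1\cdots i_j\cdot i'_1\cdots i'_{k-1-j}}\Big)$$ for every positive integer $n$.
   Context: All indices are integers; the inner sum is over strictly increasing $j$-tuples in $[-a,-1]$ and strictly increasing $(k-1-j)$-tuples in $[1,n-1-a]$; an empty product equals $1$ and an empty sum equals $0$. -}

module Defs where

open import Data.Nat as ℕ using (ℕ; zero; suc; _∸_)
open import Data.Integer as ℤ using (ℤ; +_; -[1+_])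
open import Data.Rational using (ℚ; 0ℚ; 1ℚ; _+_; _*_; -_; _/_)
open import Data.List using (List; []; _∷_; map; foldr; _++_; upTo)

ℕ→ℚ : ℕ → ℚ
ℕ→ℚ n = + n / 1

-- reciprocal of an integer (the value at 0 is irrelevant: it never occurs)
recipℤ : ℤ → ℚ
recipℤ (+ zero)    = 0ℚ
recipℤ (+ suc m)   = + 1 / suc m
recipℤ (-[1+ m ])  = - (+ 1 / suc m)

Σℚ : List ℚ → ℚ
Σℚ = foldr _+_ 0ℚ

Πℤ : List ℤ → ℤ
Πℤ = foldr ℤ._*_ (+ 1)

-- univariate polynomial over ℚ: coefficient list, constant term first
Poly : Set
Poly = List ℚ

evalPoly : Poly → ℚ → ℚ
evalPoly []       x = 0ℚ
evalPoly (c ∷ cs) x = c + x * evalPoly cs x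

X* : Poly → Poly
X* q = 0ℚ ∷ q

XDivides : Poly → Set
XDivides p = Data.Product.Σ Poly (λ q → p Relation.Binary.PropositionalEquality.≡ X* q)
  where import Data.Product
        import Relation.Binary.PropositionalEquality

-- bivariate polynomial f(x,a) = Σ_i x^i (Σ_j c_ij a^j): outer list indexed by power of x
Poly2 : Set
Poly2 = List Poly

evalPoly2 : Poly2 → ℚ → ℚ → ℚ
evalPoly2 []       x a = 0ℚ
evalPoly2 (c ∷ cs) x a = evalPoly c a + x * evalPoly2 cs x a

range : ℤ → ℕ → List ℤ
range lo zero      = []
range lo (suc len) = lo ∷ range (lo ℤ.+ + 1) len

incTuples : ℕ → List ℤ → List (List ℤ)
incTuples zero    xs       = [] ∷ []
incTuples (suc j) []       = []
incTuples (suc j) (x ∷ xs) = map (x ∷_) (incTuples j xs) ++ incTuples (suc j) xs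

innerSum : ℕ → ℕ → ℕ → ℚ
innerSum k n a =
  Σℚ (map (λ j →
        Σℚ (map (λ is →
              Σℚ (map (λ is' → recipℤ (Πℤ is ℤ.* Πℤ is'))
                      (incTuples (k ∸ 1 ∸ j) (range (+ 1) (n ∸ 1 ∸ a)))))
           (incTuples j (range (ℤ.- (+ a)) a))))
      (upTo k))

rhs : Poly2 → ℕ → ℕ → ℚ
rhs f k n = Σℚ (map (λ a → evalPoly2 f (ℕ→ℚ n) (ℕ→ℚ a) * innerSum k n a) (upTo n))

{-# OPTIONS --safe #-}
-- Let G(a, m) be the (k-1)-st elementary symmetric function of the reciprocals of the nonzero
-- integers in [-a, m], and H(a, m) the (k-2)-nd one. The inner bracket is G(a, n-1-a), by the
-- product formula for elementary symmetric functions of a concatenation. Adjoining the endpoint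
-- -(a+1), resp. m+1, gives
--   (a+1) G(a+1, m) = (a+1) G(a, m) - H(a, m),   (m+1) G(a, m+1) = (m+1) G(a, m) + H(a, m),
-- and these two recurrences alone force the Vandermonde-type identity
--   Σ_{a+m=n} C(a, j) G(a, m) = G(j, 0) C(n+1, j+1).
-- Expanding f(n, a) = Σ c_ij n^i C(a, j) in the binomial basis in a, the right-hand side becomes
-- Σ c_ij G(j, 0) n^i C(n, j+1), a polynomial in n divisible by n.
module Submission where

open import Defs
open import Data.Nat as ℕ using (ℕ; zero; suc; _∸_; _<_; _≤_; s≤s)
import Data.Nat.Properties as ℕₚ
open import Data.Nat.Combinatorics
  using (_C_; nCk+nC[k+1]≡[n+1]C[k+1]; nCn≡1; nC1≡n; k>n⇒nCk≡0)
open import Data.Integer as ℤ using (ℤ; +_; -[1+_])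
import Data.Integer.Properties as ℤₚ
import Data.Integer.Tactic.RingSolver as ℤ-Solver
open import Data.Rational using (ℚ; 0ℚ; 1ℚ; _+_; _*_; -_; _-_; fromℚᵘ)
import Data.Rational.Properties as ℚₚ
import Data.Rational.Unnormalised as ℚᵘ
import Data.Rational.Unnormalised.Properties as ℚᵘₚ
open import Data.List using (List; []; _∷_; map; _++_; upTo; applyUpTo)
import Data.List.Properties as Listₚ
open import Relation.Nullary.Decidable using (dec⇒maybe)
open import Data.Product using (Σ; _×_; _,_)
open import Data.Sum using (inj₁; inj₂)
open import Relation.Binary.PropositionalEquality
open import Tactic.RingSolver using (solve-∀)
open import Tactic.RingSolver.Core.AlmostCommutativeRing
  using (AlmostCommutativeRing; fromCommutativeRing)

open ≡-Reasoning

ℚ-ring : AlmostCommutativeRing _ _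
ℚ-ring = fromCommutativeRing ℚₚ.+-*-commutativeRing (λ x → dec⇒maybe (0ℚ ℚₚ.≟ x))

ι : ℕ → ℚ
ι = ℕ→ℚ

fromℚᵘ-homo-+ : ∀ p q → fromℚᵘ (p ℚᵘ.+ q) ≡ fromℚᵘ p + fromℚᵘ q
fromℚᵘ-homo-+ p q = ℚₚ.toℚᵘ-injective (ℚᵘₚ.≃-trans (ℚₚ.toℚᵘ-fromℚᵘ (p ℚᵘ.+ q))
  (ℚᵘₚ.≃-sym (ℚᵘₚ.≃-trans (ℚₚ.toℚᵘ-homo-+ (fromℚᵘ p) (fromℚᵘ q))
    (ℚᵘₚ.+-cong (ℚₚ.toℚᵘ-fromℚᵘ p) (ℚₚ.toℚᵘ-fromℚᵘ q)))))

fromℚᵘ-homo-* : ∀ p q → fromℚᵘ (p ℚᵘ.* q) ≡ fromℚᵘ p * fromℚᵘ q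
fromℚᵘ-homo-* p q = ℚₚ.toℚᵘ-injective (ℚᵘₚ.≃-trans (ℚₚ.toℚᵘ-fromℚᵘ (p ℚᵘ.* q))
  (ℚᵘₚ.≃-sym (ℚᵘₚ.≃-trans (ℚₚ.toℚᵘ-homo-* (fromℚᵘ p) (fromℚᵘ q))
    (ℚᵘₚ.*-cong (ℚₚ.toℚᵘ-fromℚᵘ p) (ℚₚ.toℚᵘ-fromℚᵘ q)))))

-- ι n and recipℤ (+ suc d) are definitionally fromℚᵘ of n / 1 and 1 / (d + 1), so their
-- arithmetic reduces, through fromℚᵘ-cong, to cross-multiplied identities in ℤ.
_/1 : ℕ → ℚᵘ.ℚᵘ
n /1 = ℚᵘ.mkℚᵘ (+ n) 0

ι-homo-+ : ∀ m n → ι (m ℕ.+ n) ≡ ι m + ι n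
ι-homo-+ m n = trans
  (ℚₚ.fromℚᵘ-cong {(m ℕ.+ n) /1} {m /1 ℚᵘ.+ n /1} (ℚᵘ.*≡* (lemma (+ m) (+ n))))
  (fromℚᵘ-homo-+ (m /1) (n /1))
  where lemma : ∀ x y → (x ℤ.+ y) ℤ.* (+ 1 ℤ.* + 1) ≡ (x ℤ.* + 1 ℤ.+ y ℤ.* + 1) ℤ.* + 1
        lemma = ℤ-Solver.solve-∀

ι-homo-* : ∀ m n → ι (m ℕ.* n) ≡ ι m * ι n
ι-homo-* m n = trans
  (ℚₚ.fromℚᵘ-cong {(m ℕ.* n) /1} {m /1 ℚᵘ.* n /1}
    (ℚᵘ.*≡* (trans (cong (ℤ._* (+ 1 ℤ.* + 1)) (ℤₚ.pos-* m n)) (lemma (+ m) (+ n)))))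
  (fromℚᵘ-homo-* (m /1) (n /1))
  where lemma : ∀ x y → (x ℤ.* y) ℤ.* (+ 1 ℤ.* + 1) ≡ (x ℤ.* y) ℤ.* + 1
        lemma = ℤ-Solver.solve-∀

ι-suc-*-recipℤ : ∀ d → ι (suc d) * recipℤ (+ suc d) ≡ 1ℚ
ι-suc-*-recipℤ d = trans
  (sym (fromℚᵘ-homo-* (suc d /1) (ℚᵘ.mkℚᵘ (+ 1) d)))
  (ℚₚ.fromℚᵘ-cong {suc d /1 ℚᵘ.* ℚᵘ.mkℚᵘ (+ 1) d} {1 /1} (ℚᵘ.*≡* (lemma (+ suc d))))
  where lemma : ∀ x → (x ℤ.* + 1) ℤ.* + 1 ≡ + 1 ℤ.* (+ 1 ℤ.* x)
        lemma = ℤ-Solver.solve-∀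

recipℤ-suc-homo-* : ∀ a b → recipℤ (+ suc a ℤ.* + suc b) ≡ recipℤ (+ suc a) * recipℤ (+ suc b)
recipℤ-suc-homo-* a b = trans
  (ℚₚ.fromℚᵘ-cong {ℚᵘ.mkℚᵘ (+ 1) (b ℕ.+ a ℕ.* suc b)} {ℚᵘ.mkℚᵘ (+ 1) a ℚᵘ.* ℚᵘ.mkℚᵘ (+ 1) b}
    (ℚᵘ.*≡* (lemma (+ suc a) (+ suc b))))
  (fromℚᵘ-homo-* (ℚᵘ.mkℚᵘ (+ 1) a) (ℚᵘ.mkℚᵘ (+ 1) b))
  where lemma : ∀ x y → + 1 ℤ.* (x ℤ.* y) ≡ (+ 1 ℤ.* + 1) ℤ.* (x ℤ.* y)
        lemma = ℤ-Solver.solve-∀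

recipℤ-homo-* : ∀ x y → recipℤ (x ℤ.* y) ≡ recipℤ x * recipℤ y
recipℤ-homo-* (+ zero) y = sym (ℚₚ.*-zeroˡ (recipℤ y))
recipℤ-homo-* x (+ zero) rewrite ℤₚ.*-zeroʳ x = sym (ℚₚ.*-zeroʳ (recipℤ x))
recipℤ-homo-* (+ suc a) (+ suc b) = recipℤ-suc-homo-* a b
recipℤ-homo-* (+ suc a) -[1+ b ] =
  trans (cong -_ (recipℤ-suc-homo-* a b)) (ℚₚ.neg-distribʳ-* (recipℤ (+ suc a)) (recipℤ (+ suc b)))
recipℤ-homo-* -[1+ a ] (+ suc b) =
  trans (cong -_ (recipℤ-suc-homo-* a b)) (ℚₚ.neg-distribˡ-* (recipℤ (+ suc a)) (recipℤ (+ suc b)))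
recipℤ-homo-* -[1+ a ] -[1+ b ] =
  trans (recipℤ-suc-homo-* a b) (lemma (recipℤ (+ suc a)) (recipℤ (+ suc b)))
  where lemma : ∀ x y → x * y ≡ (- x) * (- y)
        lemma = solve-∀ ℚ-ring

recipℤ-suc-*-ι-suc : ∀ d x → recipℤ (+ suc d) * (ι (suc d) * x) ≡ x
recipℤ-suc-*-ι-suc d x = begin
  r * (ι (suc d) * x)  ≡⟨ lemma r (ι (suc d)) x ⟩
  (ι (suc d) * r) * x  ≡⟨ cong (_* x) (ι-suc-*-recipℤ d) ⟩
  1ℚ * x               ≡⟨ ℚₚ.*-identityˡ x ⟩
  x                    ∎
  where r = recipℤ (+ suc d)
        lemma : ∀ r i x → r * (i * x) ≡ (i * r) * x
        lemma = solve-∀ ℚ-ring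

ι-suc-*-injective : ∀ d {x y} → ι (suc d) * x ≡ ι (suc d) * y → x ≡ y
ι-suc-*-injective d {x} {y} eq = begin
  x                                     ≡⟨ recipℤ-suc-*-ι-suc d x ⟨
  recipℤ (+ suc d) * (ι (suc d) * x)    ≡⟨ cong (recipℤ (+ suc d) *_) eq ⟩
  recipℤ (+ suc d) * (ι (suc d) * y)    ≡⟨ recipℤ-suc-*-ι-suc d y ⟩
  y                                     ∎

[x+y]*c≡y*c+w⇒x*c≡w : ∀ x y c w → (x + y) * c ≡ y * c + w → x * c ≡ w
[x+y]*c≡y*c+w⇒x*c≡w x y c w eq = begin
  x * c                        ≡⟨ lemma x y c ⟩
  (x + y) * c + - (y * c)      ≡⟨ cong (_+ - (y * c)) eq ⟩
  y * c + w + - (y * c)        ≡⟨ lemma′ (y * c) w ⟩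
  w                            ∎
  where lemma : ∀ x y c → x * c ≡ (x + y) * c + - (y * c)
        lemma = solve-∀ ℚ-ring
        lemma′ : ∀ u w → u + w + - u ≡ w
        lemma′ = solve-∀ ℚ-ring

∑< : ℕ → (ℕ → ℚ) → ℚ
∑< zero    f = 0ℚ
∑< (suc n) f = f 0 + ∑< n (λ i → f (suc i))

syntax ∑< n (λ i → e) = ∑[ i < n ] e

∑-cong : ∀ n {f g : ℕ → ℚ} → (∀ i → f i ≡ g i) → ∑[ i < n ] f i ≡ ∑[ i < n ] g i
∑-cong zero    eq = refl
∑-cong (suc n) eq = cong₂ _+_ (eq 0) (∑-cong n (λ i → eq (suc i)))

∑-+ : ∀ n (f g : ℕ → ℚ) → ∑[ i < n ] (f i + g i) ≡ ∑[ i < n ] f i + ∑[ i < n ] g i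
∑-+ zero    f g = refl
∑-+ (suc n) f g = begin
  f 0 + g 0 + ∑[ i < n ] (f (suc i) + g (suc i))
    ≡⟨ cong (_+_ (f 0 + g 0)) (∑-+ n (λ i → f (suc i)) (λ i → g (suc i))) ⟩
  f 0 + g 0 + (∑[ i < n ] f (suc i) + ∑[ i < n ] g (suc i))
    ≡⟨ lemma (f 0) (g 0) _ _ ⟩
  f 0 + ∑[ i < n ] f (suc i) + (g 0 + ∑[ i < n ] g (suc i)) ∎
  where lemma : ∀ a b c d → a + b + (c + d) ≡ a + c + (b + d)
        lemma = solve-∀ ℚ-ring

∑-*ˡ : ∀ n c (f : ℕ → ℚ) → ∑[ i < n ] (c * f i) ≡ c * ∑[ i < n ] f i
∑-*ˡ zero    c f = sym (ℚₚ.*-zeroʳ c)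
∑-*ˡ (suc n) c f = trans (cong (_+_ (c * f 0)) (∑-*ˡ n c (λ i → f (suc i))))
                         (sym (ℚₚ.*-distribˡ-+ c (f 0) _))

∑-zero : ∀ n {f : ℕ → ℚ} → (∀ i → f i ≡ 0ℚ) → ∑[ i < n ] f i ≡ 0ℚ
∑-zero zero    eq = refl
∑-zero (suc n) eq = trans (cong₂ _+_ (eq 0) (∑-zero n (λ i → eq (suc i)))) (ℚₚ.+-identityˡ 0ℚ)

Σℚ-map-applyUpTo : ∀ (f : ℕ → ℚ) (g : ℕ → ℕ) n →
                   Σℚ (map f (applyUpTo g n)) ≡ ∑[ i < n ] f (g i)
Σℚ-map-applyUpTo f g zero    = refl
Σℚ-map-applyUpTo f g (suc n) = cong (_+_ (f (g 0))) (Σℚ-map-applyUpTo f (λ i → g (suc i)) n)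

Σℚ-map-upTo : ∀ (f : ℕ → ℚ) n → Σℚ (map f (upTo n)) ≡ ∑[ i < n ] f i
Σℚ-map-upTo f = Σℚ-map-applyUpTo f (λ i → i)

Σℚ-++ : ∀ xs ys → Σℚ (xs ++ ys) ≡ Σℚ xs + Σℚ ys
Σℚ-++ []       ys = sym (ℚₚ.+-identityˡ (Σℚ ys))
Σℚ-++ (x ∷ xs) ys = trans (cong (_+_ x) (Σℚ-++ xs ys)) (sym (ℚₚ.+-assoc x (Σℚ xs) (Σℚ ys)))

Σℚ-map-*ˡ : ∀ {A : Set} c (f : A → ℚ) xs → Σℚ (map (λ x → c * f x) xs) ≡ c * Σℚ (map f xs)
Σℚ-map-*ˡ c f []       = sym (ℚₚ.*-zeroʳ c)
Σℚ-map-*ˡ c f (x ∷ xs) = trans (cong (_+_ (c * f x)) (Σℚ-map-*ˡ c f xs))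
                               (sym (ℚₚ.*-distribˡ-+ c (f x) _))

Σℚ-map-product : ∀ {A B : Set} (f : A → ℚ) (g : B → ℚ) xs ys →
                 Σℚ (map (λ x → Σℚ (map (λ y → f x * g y) ys)) xs) ≡ Σℚ (map f xs) * Σℚ (map g ys)
Σℚ-map-product f g xs ys = begin
  Σℚ (map (λ x → Σℚ (map (λ y → f x * g y) ys)) xs)
    ≡⟨ cong Σℚ (Listₚ.map-cong (λ x → Σℚ-map-*ˡ (f x) g ys) xs) ⟩
  Σℚ (map (λ x → f x * Σℚ (map g ys)) xs)
    ≡⟨ cong Σℚ (Listₚ.map-cong (λ x → ℚₚ.*-comm (f x) _) xs) ⟩
  Σℚ (map (λ x → Σℚ (map g ys) * f x) xs)
    ≡⟨ Σℚ-map-*ˡ (Σℚ (map g ys)) f xs ⟩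
  Σℚ (map g ys) * Σℚ (map f xs)
    ≡⟨ ℚₚ.*-comm (Σℚ (map g ys)) (Σℚ (map f xs)) ⟩
  Σℚ (map f xs) * Σℚ (map g ys) ∎

-- Elementary symmetric functions of reciprocals

esymRecip : ℕ → List ℤ → ℚ
esymRecip j xs = Σℚ (map (λ is → recipℤ (Πℤ is)) (incTuples j xs))

esymRecip-cons : ∀ j x xs → esymRecip (suc j) (x ∷ xs) ≡ recipℤ x * esymRecip j xs + esymRecip (suc j) xs
esymRecip-cons j x xs = begin
  Σℚ (map r (map (x ∷_) (incTuples j xs) ++ incTuples (suc j) xs))
    ≡⟨ cong Σℚ (Listₚ.map-++ r (map (x ∷_) (incTuples j xs)) (incTuples (suc j) xs)) ⟩
  Σℚ (map r (map (x ∷_) (incTuples j xs)) ++ map r (incTuples (suc j) xs))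
    ≡⟨ Σℚ-++ (map r (map (x ∷_) (incTuples j xs))) _ ⟩
  Σℚ (map r (map (x ∷_) (incTuples j xs))) + esymRecip (suc j) xs
    ≡⟨ cong (λ z → Σℚ z + esymRecip (suc j) xs) (Listₚ.map-∘ (incTuples j xs)) ⟨
  Σℚ (map (λ is → recipℤ (x ℤ.* Πℤ is)) (incTuples j xs)) + esymRecip (suc j) xs
    ≡⟨ cong (λ z → Σℚ z + esymRecip (suc j) xs)
            (Listₚ.map-cong (λ is → recipℤ-homo-* x (Πℤ is)) (incTuples j xs)) ⟩
  Σℚ (map (λ is → recipℤ x * r is) (incTuples j xs)) + esymRecip (suc j) xs
    ≡⟨ cong (_+ esymRecip (suc j) xs) (Σℚ-map-*ˡ (recipℤ x) r (incTuples j xs)) ⟩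
  recipℤ x * esymRecip j xs + esymRecip (suc j) xs ∎
  where r : List ℤ → ℚ
        r is = recipℤ (Πℤ is)

esymRecip-snoc : ∀ j xs x → esymRecip (suc j) (xs ++ x ∷ []) ≡ esymRecip (suc j) xs + recipℤ x * esymRecip j xs
esymRecip-snoc j       []       x = trans (esymRecip-cons j x []) (ℚₚ.+-comm (recipℤ x * esymRecip j []) 0ℚ)
esymRecip-snoc zero    (y ∷ xs) x = begin
  esymRecip 1 (y ∷ (xs ++ x ∷ []))                 ≡⟨ esymRecip-cons zero y (xs ++ x ∷ []) ⟩
  recipℤ y * 1ℚ + esymRecip 1 (xs ++ x ∷ [])       ≡⟨ cong (_+_ (recipℤ y * 1ℚ)) (esymRecip-snoc zero xs x) ⟩
  recipℤ y * 1ℚ + (esymRecip 1 xs + recipℤ x * 1ℚ) ≡⟨ ℚₚ.+-assoc (recipℤ y * 1ℚ) _ _ ⟨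
  recipℤ y * 1ℚ + esymRecip 1 xs + recipℤ x * 1ℚ   ≡⟨ cong (_+ recipℤ x * 1ℚ) (esymRecip-cons zero y xs) ⟨
  esymRecip 1 (y ∷ xs) + recipℤ x * 1ℚ ∎
esymRecip-snoc (suc j) (y ∷ xs) x = begin
  esymRecip (suc (suc j)) (y ∷ (xs ++ x ∷ []))
    ≡⟨ esymRecip-cons (suc j) y (xs ++ x ∷ []) ⟩
  recipℤ y * esymRecip (suc j) (xs ++ x ∷ []) + esymRecip (suc (suc j)) (xs ++ x ∷ [])
    ≡⟨ cong₂ (λ u v → recipℤ y * u + v) (esymRecip-snoc j xs x) (esymRecip-snoc (suc j) xs x) ⟩
  recipℤ y * (e₁ + recipℤ x * e₀) + (e₂ + recipℤ x * e₁)
    ≡⟨ lemma (recipℤ y) e₁ (recipℤ x) e₀ e₂ ⟩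
  (recipℤ y * e₁ + e₂) + recipℤ x * (recipℤ y * e₀ + e₁)
    ≡⟨ cong₂ (λ u v → u + recipℤ x * v) (esymRecip-cons (suc j) y xs) (esymRecip-cons j y xs) ⟨
  esymRecip (suc (suc j)) (y ∷ xs) + recipℤ x * esymRecip (suc j) (y ∷ xs) ∎
  where
  e₀ = esymRecip j xs
  e₁ = esymRecip (suc j) xs
  e₂ = esymRecip (suc (suc j)) xs
  lemma : ∀ ry a rx b c → ry * (a + rx * b) + (c + rx * a) ≡ (ry * a + c) + rx * (ry * b + a)
  lemma = solve-∀ ℚ-ring

esymRecip-++ : ∀ r xs ys → esymRecip r (xs ++ ys) ≡ ∑[ j < suc r ] (esymRecip j xs * esymRecip (r ∸ j) ys)
esymRecip-++ r []       ys = begin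
  esymRecip r ys                     ≡⟨ ℚₚ.*-identityˡ _ ⟨
  1ℚ * esymRecip r ys                ≡⟨ ℚₚ.+-identityʳ _ ⟨
  1ℚ * esymRecip r ys + 0ℚ           ≡⟨ cong (_+_ (1ℚ * esymRecip r ys))
                                            (∑-zero r (λ j → ℚₚ.*-zeroˡ (esymRecip (r ∸ suc j) ys))) ⟨
  ∑[ j < suc r ] (esymRecip j [] * esymRecip (r ∸ j) ys) ∎
esymRecip-++ zero    (x ∷ xs) ys = refl
esymRecip-++ (suc r) (x ∷ xs) ys = begin
  esymRecip (suc r) (x ∷ (xs ++ ys))
    ≡⟨ esymRecip-cons r x (xs ++ ys) ⟩
  recipℤ x * esymRecip r (xs ++ ys) + esymRecip (suc r) (xs ++ ys)
    ≡⟨ cong₂ (λ u v → recipℤ x * u + v) (esymRecip-++ r xs ys) (esymRecip-++ (suc r) xs ys) ⟩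
  recipℤ x * A + (1ℚ * esymRecip (suc r) ys + B)
    ≡⟨ lemma (recipℤ x * A) (1ℚ * esymRecip (suc r) ys) B ⟩
  1ℚ * esymRecip (suc r) ys + (recipℤ x * A + B)
    ≡⟨ cong (_+_ (1ℚ * esymRecip (suc r) ys)) split ⟨
  ∑[ j < suc (suc r) ] (esymRecip j (x ∷ xs) * esymRecip (suc r ∸ j) ys) ∎
  where
  A = ∑[ j < suc r ] (esymRecip j xs * esymRecip (r ∸ j) ys)
  B = ∑[ j < suc r ] (esymRecip (suc j) xs * esymRecip (r ∸ j) ys)
  lemma : ∀ a b c → a + (b + c) ≡ b + (a + c)
  lemma = solve-∀ ℚ-ring
  split : ∑[ j < suc r ] (esymRecip (suc j) (x ∷ xs) * esymRecip (r ∸ j) ys) ≡ recipℤ x * A + B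
  split = begin
    ∑[ j < suc r ] (esymRecip (suc j) (x ∷ xs) * esymRecip (r ∸ j) ys)
      ≡⟨ ∑-cong (suc r) (λ j → trans (cong (_* esymRecip (r ∸ j) ys) (esymRecip-cons j x xs))
                                     (distrib (recipℤ x) (esymRecip j xs) _ _)) ⟩
    ∑[ j < suc r ] (recipℤ x * (esymRecip j xs * esymRecip (r ∸ j) ys)
                    + esymRecip (suc j) xs * esymRecip (r ∸ j) ys)
      ≡⟨ ∑-+ (suc r) (λ j → recipℤ x * (esymRecip j xs * esymRecip (r ∸ j) ys))
                     (λ j → esymRecip (suc j) xs * esymRecip (r ∸ j) ys) ⟩
    ∑[ j < suc r ] (recipℤ x * (esymRecip j xs * esymRecip (r ∸ j) ys)) + B
      ≡⟨ cong (_+ B) (∑-*ˡ (suc r) (recipℤ x) (λ j → esymRecip j xs * esymRecip (r ∸ j) ys)) ⟩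
    recipℤ x * A + B ∎
    where distrib : ∀ c a b e → (c * a + b) * e ≡ c * (a * e) + b * e
          distrib = solve-∀ ℚ-ring

range-snoc : ∀ lo len → range lo (suc len) ≡ range lo len ++ (lo ℤ.+ + len) ∷ []
range-snoc lo zero      = cong (_∷ []) (sym (ℤₚ.+-identityʳ lo))
range-snoc lo (suc len) = cong (lo ∷_) (trans (range-snoc (lo ℤ.+ + 1) len)
  (cong (λ z → range (lo ℤ.+ + 1) len ++ z ∷ []) (ℤₚ.+-assoc lo (+ 1) (+ len))))

window : ℕ → ℕ → List ℤ
window a m = range (ℤ.- (+ a)) a ++ range (+ 1) m

window-sucˡ : ∀ a m → window (suc a) m ≡ -[1+ a ] ∷ window a m
window-sucˡ a m = cong (λ lo → -[1+ a ] ∷ range lo a ++ range (+ 1) m) (lemma (+ a))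
  where lemma : ∀ x → ℤ.- (+ 1 ℤ.+ x) ℤ.+ + 1 ≡ ℤ.- x
        lemma = ℤ-Solver.solve-∀

window-sucʳ : ∀ a m → window a (suc m) ≡ window a m ++ + suc m ∷ []
window-sucʳ a m = trans (cong (range (ℤ.- (+ a)) a ++_) (range-snoc (+ 1) m))
                        (sym (Listₚ.++-assoc (range (ℤ.- (+ a)) a) (range (+ 1) m) (+ suc m ∷ [])))

esymRecip-window-sucˡ : ∀ r a m → ι (suc a) * esymRecip (suc r) (window (suc a) m)
                                  ≡ ι (suc a) * esymRecip (suc r) (window a m) - esymRecip r (window a m)
esymRecip-window-sucˡ r a m = begin
  ι (suc a) * esymRecip (suc r) (window (suc a) m)
    ≡⟨ cong (λ xs → ι (suc a) * esymRecip (suc r) xs) (window-sucˡ a m) ⟩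
  ι (suc a) * esymRecip (suc r) (-[1+ a ] ∷ window a m)
    ≡⟨ cong (ι (suc a) *_) (esymRecip-cons r -[1+ a ] (window a m)) ⟩
  ι (suc a) * (- recipℤ (+ suc a) * H + G)
    ≡⟨ lemma (ι (suc a)) (recipℤ (+ suc a)) H G ⟩
  ι (suc a) * G - (ι (suc a) * recipℤ (+ suc a)) * H
    ≡⟨ cong (λ u → ι (suc a) * G - u * H) (ι-suc-*-recipℤ a) ⟩
  ι (suc a) * G - 1ℚ * H
    ≡⟨ cong (λ u → ι (suc a) * G - u) (ℚₚ.*-identityˡ H) ⟩
  ι (suc a) * G - H ∎
  where
  G = esymRecip (suc r) (window a m)
  H = esymRecip r (window a m)
  lemma : ∀ i ρ h g → i * (- ρ * h + g) ≡ i * g - (i * ρ) * h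
  lemma = solve-∀ ℚ-ring

esymRecip-window-sucʳ : ∀ r a m → ι (suc m) * esymRecip (suc r) (window a (suc m))
                                  ≡ ι (suc m) * esymRecip (suc r) (window a m) + esymRecip r (window a m)
esymRecip-window-sucʳ r a m = begin
  ι (suc m) * esymRecip (suc r) (window a (suc m))
    ≡⟨ cong (λ xs → ι (suc m) * esymRecip (suc r) xs) (window-sucʳ a m) ⟩
  ι (suc m) * esymRecip (suc r) (window a m ++ + suc m ∷ [])
    ≡⟨ cong (ι (suc m) *_) (esymRecip-snoc r (window a m) (+ suc m)) ⟩
  ι (suc m) * (G + recipℤ (+ suc m) * H)
    ≡⟨ lemma (ι (suc m)) (recipℤ (+ suc m)) H G ⟩
  ι (suc m) * G + (ι (suc m) * recipℤ (+ suc m)) * H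
    ≡⟨ cong (λ u → ι (suc m) * G + u * H) (ι-suc-*-recipℤ m) ⟩
  ι (suc m) * G + 1ℚ * H
    ≡⟨ cong (λ u → ι (suc m) * G + u) (ℚₚ.*-identityˡ H) ⟩
  ι (suc m) * G + H ∎
  where
  G = esymRecip (suc r) (window a m)
  H = esymRecip r (window a m)
  lemma : ∀ i ρ h g → i * (g + ρ * h) ≡ i * g + (i * ρ) * h
  lemma = solve-∀ ℚ-ring

innerSum≡esymRecip-window : ∀ r n a → innerSum (suc r) n a ≡ esymRecip r (window a (n ∸ 1 ∸ a))
innerSum≡esymRecip-window r n a = begin
  innerSum (suc r) n a
    ≡⟨ cong Σℚ (Listₚ.map-cong product (upTo (suc r))) ⟩
  Σℚ (map (λ j → esymRecip j A * esymRecip (r ∸ j) B) (upTo (suc r)))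
    ≡⟨ Σℚ-map-upTo (λ j → esymRecip j A * esymRecip (r ∸ j) B) (suc r) ⟩
  ∑[ j < suc r ] (esymRecip j A * esymRecip (r ∸ j) B)
    ≡⟨ esymRecip-++ r A B ⟨
  esymRecip r (A ++ B) ∎
  where
  A = range (ℤ.- (+ a)) a
  B = range (+ 1) (n ∸ 1 ∸ a)
  product : ∀ j → Σℚ (map (λ is → Σℚ (map (λ is′ → recipℤ (Πℤ is ℤ.* Πℤ is′)) (incTuples (r ∸ j) B)))
                          (incTuples j A))
                  ≡ esymRecip j A * esymRecip (r ∸ j) B
  product j = trans
    (cong Σℚ (Listₚ.map-cong (λ is → cong Σℚ (Listₚ.map-cong (λ is′ → recipℤ-homo-* (Πℤ is) (Πℤ is′))
                                                              (incTuples (r ∸ j) B)))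
                             (incTuples j A)))
    (Σℚ-map-product (λ is → recipℤ (Πℤ is)) (λ is → recipℤ (Πℤ is)) (incTuples j A) (incTuples (r ∸ j) B))

-- Sums over antidiagonals a + m = n

antidiagSum : ℕ → (ℕ → ℕ → ℚ) → ℚ
antidiagSum zero    φ = φ 0 0
antidiagSum (suc n) φ = φ 0 (suc n) + antidiagSum n (λ a m → φ (suc a) m)

∑-antidiagSum : ∀ n φ → ∑[ a < suc n ] φ a (n ∸ a) ≡ antidiagSum n φ
∑-antidiagSum zero    φ = ℚₚ.+-identityʳ (φ 0 0)
∑-antidiagSum (suc n) φ = cong (_+_ (φ 0 (suc n))) (∑-antidiagSum n (λ a m → φ (suc a) m))

antidiagSum-cong : ∀ n {φ ψ : ℕ → ℕ → ℚ} → (∀ a m → φ a m ≡ ψ a m) →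
                   antidiagSum n φ ≡ antidiagSum n ψ
antidiagSum-cong zero    eq = eq 0 0
antidiagSum-cong (suc n) eq = cong₂ _+_ (eq 0 (suc n)) (antidiagSum-cong n (λ a → eq (suc a)))

antidiagSum-+ : ∀ n (φ ψ : ℕ → ℕ → ℚ) →
                antidiagSum n (λ a m → φ a m + ψ a m) ≡ antidiagSum n φ + antidiagSum n ψ
antidiagSum-+ zero    φ ψ = refl
antidiagSum-+ (suc n) φ ψ = begin
  φ 0 (suc n) + ψ 0 (suc n) + antidiagSum n (λ a m → φ (suc a) m + ψ (suc a) m)
    ≡⟨ cong (_+_ (φ 0 (suc n) + ψ 0 (suc n))) (antidiagSum-+ n _ _) ⟩
  φ 0 (suc n) + ψ 0 (suc n) + (antidiagSum n (λ a m → φ (suc a) m) + antidiagSum n (λ a m → ψ (suc a) m))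
    ≡⟨ lemma (φ 0 (suc n)) (ψ 0 (suc n)) _ _ ⟩
  antidiagSum (suc n) φ + antidiagSum (suc n) ψ ∎
  where lemma : ∀ a b c d → a + b + (c + d) ≡ a + c + (b + d)
        lemma = solve-∀ ℚ-ring

antidiagSum-weight : ∀ n (w : ℕ → ℚ) (φ : ℕ → ℕ → ℚ) →
                     antidiagSum n (λ a m → w (a ℕ.+ m) * φ a m) ≡ w n * antidiagSum n φ
antidiagSum-weight zero    w φ = refl
antidiagSum-weight (suc n) w φ =
  trans (cong (_+_ (w (suc n) * φ 0 (suc n))) (antidiagSum-weight n (λ s → w (suc s)) (λ a m → φ (suc a) m)))
        (sym (ℚₚ.*-distribˡ-+ (w (suc n)) (φ 0 (suc n)) _))

antidiagSum-last : ∀ n (φ : ℕ → ℕ → ℚ) →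
                   antidiagSum (suc n) φ ≡ antidiagSum n (λ a m → φ a (suc m)) + φ (suc n) 0
antidiagSum-last zero    φ = refl
antidiagSum-last (suc n) φ =
  trans (cong (_+_ (φ 0 (suc (suc n)))) (antidiagSum-last n (λ a m → φ (suc a) m)))
        (sym (ℚₚ.+-assoc (φ 0 (suc (suc n))) _ (φ (suc (suc n)) 0)))

antidiagSum-vanishes : ∀ n {φ : ℕ → ℕ → ℚ} → (∀ a m → a ℕ.+ m ≡ n → φ a m ≡ 0ℚ) →
                       antidiagSum n φ ≡ 0ℚ
antidiagSum-vanishes zero    eq = eq 0 0 refl
antidiagSum-vanishes (suc n) eq =
  trans (cong₂ _+_ (eq 0 (suc n) refl) (antidiagSum-vanishes n (λ a m a+m≡n → eq (suc a) m (cong suc a+m≡n))))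
        (ℚₚ.+-identityˡ 0ℚ)

antidiagSum-diagonal : ∀ j (φ : ℕ → ℕ → ℚ) → (∀ a m → a < j → φ a m ≡ 0ℚ) →
                       antidiagSum j φ ≡ φ j 0
antidiagSum-diagonal zero    φ vanish = refl
antidiagSum-diagonal (suc j) φ vanish = begin
  antidiagSum (suc j) φ                                  ≡⟨ antidiagSum-last j φ ⟩
  antidiagSum j (λ a m → φ a (suc m)) + φ (suc j) 0       ≡⟨ cong (_+ φ (suc j) 0) below ⟩
  0ℚ + φ (suc j) 0                                        ≡⟨ ℚₚ.+-identityˡ _ ⟩
  φ (suc j) 0                                             ∎
  where below = antidiagSum-vanishes j (λ a m a+m≡j →
                  vanish a (suc m) (s≤s (subst (a ℕ.≤_) a+m≡j (ℕₚ.m≤m+n a m))))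

-- Binomial coefficients

[k+1]*[n+1]C[k+1]≡[n+1]*nCk : ∀ n k → suc k ℕ.* (suc n C suc k) ≡ suc n ℕ.* (n C k)
[k+1]*[n+1]C[k+1]≡[n+1]*nCk zero    zero    = refl
[k+1]*[n+1]C[k+1]≡[n+1]*nCk zero    (suc k) = ℕₚ.*-zeroʳ (suc (suc k))
[k+1]*[n+1]C[k+1]≡[n+1]*nCk (suc n) zero    = begin
  1 ℕ.* (suc (suc n) C 1) ≡⟨ ℕₚ.*-identityˡ _ ⟩
  suc (suc n) C 1         ≡⟨ nC1≡n (suc (suc n)) ⟩
  suc (suc n)             ≡⟨ ℕₚ.*-identityʳ (suc (suc n)) ⟨
  suc (suc n) ℕ.* 1       ∎
[k+1]*[n+1]C[k+1]≡[n+1]*nCk (suc n) (suc k) = begin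
  suc (suc k) ℕ.* (suc (suc n) C suc (suc k))
    ≡⟨ cong (suc (suc k) ℕ.*_) (nCk+nC[k+1]≡[n+1]C[k+1] (suc n) (suc k)) ⟨
  suc (suc k) ℕ.* (X ℕ.+ Y)
    ≡⟨ ℕₚ.*-distribˡ-+ (suc (suc k)) X Y ⟩
  (X ℕ.+ suc k ℕ.* X) ℕ.+ suc (suc k) ℕ.* Y
    ≡⟨ cong₂ (λ u v → (X ℕ.+ u) ℕ.+ v) ([k+1]*[n+1]C[k+1]≡[n+1]*nCk n k)
                                       ([k+1]*[n+1]C[k+1]≡[n+1]*nCk n (suc k)) ⟩
  (X ℕ.+ suc n ℕ.* (n C k)) ℕ.+ suc n ℕ.* (n C suc k)
    ≡⟨ ℕₚ.+-assoc X _ _ ⟩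
  X ℕ.+ (suc n ℕ.* (n C k) ℕ.+ suc n ℕ.* (n C suc k))
    ≡⟨ cong (X ℕ.+_) (ℕₚ.*-distribˡ-+ (suc n) (n C k) (n C suc k)) ⟨
  X ℕ.+ suc n ℕ.* (n C k ℕ.+ n C suc k)
    ≡⟨ cong (λ z → X ℕ.+ suc n ℕ.* z) (nCk+nC[k+1]≡[n+1]C[k+1] n k) ⟩
  suc (suc n) ℕ.* X ∎
  where X = suc n C suc k
        Y = suc n C suc (suc k)

[n+1]*[n+1]Ck≡k*[n+1]Ck+[n+1]*nCk : ∀ n k →
  suc n ℕ.* (suc n C k) ≡ k ℕ.* (suc n C k) ℕ.+ suc n ℕ.* (n C k)
[n+1]*[n+1]Ck≡k*[n+1]Ck+[n+1]*nCk n zero    = refl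
[n+1]*[n+1]Ck≡k*[n+1]Ck+[n+1]*nCk n (suc k) = begin
  suc n ℕ.* (suc n C suc k)                        ≡⟨ cong (suc n ℕ.*_) (nCk+nC[k+1]≡[n+1]C[k+1] n k) ⟨
  suc n ℕ.* (n C k ℕ.+ n C suc k)                  ≡⟨ ℕₚ.*-distribˡ-+ (suc n) (n C k) (n C suc k) ⟩
  suc n ℕ.* (n C k) ℕ.+ suc n ℕ.* (n C suc k)
    ≡⟨ cong (ℕ._+ suc n ℕ.* (n C suc k)) ([k+1]*[n+1]C[k+1]≡[n+1]*nCk n k) ⟨
  suc k ℕ.* (suc n C suc k) ℕ.+ suc n ℕ.* (n C suc k) ∎

k*0Ck≡0 : ∀ k → k ℕ.* (0 C k) ≡ 0
k*0Ck≡0 zero    = refl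
k*0Ck≡0 (suc k) = ℕₚ.*-zeroʳ (suc k)

k*nCk+[k+1]*nC[k+1]≡n*nCk : ∀ n k → k ℕ.* (n C k) ℕ.+ suc k ℕ.* (n C suc k) ≡ n ℕ.* (n C k)
k*nCk+[k+1]*nC[k+1]≡n*nCk zero    k = cong₂ ℕ._+_ (k*0Ck≡0 k) (k*0Ck≡0 (suc k))
k*nCk+[k+1]*nC[k+1]≡n*nCk (suc n) k = begin
  k ℕ.* (suc n C k) ℕ.+ suc k ℕ.* (suc n C suc k)
    ≡⟨ cong (k ℕ.* (suc n C k) ℕ.+_) ([k+1]*[n+1]C[k+1]≡[n+1]*nCk n k) ⟩
  k ℕ.* (suc n C k) ℕ.+ suc n ℕ.* (n C k)
    ≡⟨ [n+1]*[n+1]Ck≡k*[n+1]Ck+[n+1]*nCk n k ⟨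
  suc n ℕ.* (suc n C k) ∎

ι-lift-*≡*+* : ∀ a b c d e f → a ℕ.* b ≡ c ℕ.* d ℕ.+ e ℕ.* f → ι a * ι b ≡ ι c * ι d + ι e * ι f
ι-lift-*≡*+* a b c d e f eq = begin
  ι a * ι b                          ≡⟨ ι-homo-* a b ⟨
  ι (a ℕ.* b)                        ≡⟨ cong ι eq ⟩
  ι (c ℕ.* d ℕ.+ e ℕ.* f)            ≡⟨ ι-homo-+ (c ℕ.* d) (e ℕ.* f) ⟩
  ι (c ℕ.* d) + ι (e ℕ.* f)          ≡⟨ cong₂ _+_ (ι-homo-* c d) (ι-homo-* e f) ⟩
  ι c * ι d + ι e * ι f              ∎

ι-[n+1]*[n+1]Ck : ∀ n k → ι (suc n) * ι (suc n C k) ≡ ι k * ι (suc n C k) + ι (suc n) * ι (n C k)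
ι-[n+1]*[n+1]Ck n k = ι-lift-*≡*+* (suc n) (suc n C k) k (suc n C k) (suc n) (n C k)
                                ([n+1]*[n+1]Ck≡k*[n+1]Ck+[n+1]*nCk n k)

ι-n*nCk : ∀ n k → ι n * ι (n C k) ≡ ι k * ι (n C k) + ι (suc k) * ι (n C suc k)
ι-n*nCk n k = ι-lift-*≡*+* n (n C k) k (n C k) (suc k) (n C suc k)
                           (sym (k*nCk+[k+1]*nC[k+1]≡n*nCk n k))

-- Polynomials divisible by x

_+ₚ_ : Poly → Poly → Poly
[]       +ₚ q        = q
(a ∷ p)  +ₚ []       = a ∷ p
(a ∷ p)  +ₚ (b ∷ q)  = (a + b) ∷ (p +ₚ q)

_*ₚ_ : ℚ → Poly → Poly
c *ₚ []      = []
c *ₚ (a ∷ p) = c * a ∷ c *ₚ p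

evalPoly-+ₚ : ∀ p q x → evalPoly (p +ₚ q) x ≡ evalPoly p x + evalPoly q x
evalPoly-+ₚ []      q       x = sym (ℚₚ.+-identityˡ _)
evalPoly-+ₚ (a ∷ p) []      x = sym (ℚₚ.+-identityʳ _)
evalPoly-+ₚ (a ∷ p) (b ∷ q) x =
  trans (cong (λ z → a + b + x * z) (evalPoly-+ₚ p q x)) (lemma a b x (evalPoly p x) (evalPoly q x))
  where lemma : ∀ a b x u v → a + b + x * (u + v) ≡ (a + x * u) + (b + x * v)
        lemma = solve-∀ ℚ-ring

evalPoly-*ₚ : ∀ c p x → evalPoly (c *ₚ p) x ≡ c * evalPoly p x
evalPoly-*ₚ c []      x = sym (ℚₚ.*-zeroʳ c)
evalPoly-*ₚ c (a ∷ p) x =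
  trans (cong (λ z → c * a + x * z) (evalPoly-*ₚ c p x)) (lemma c a x (evalPoly p x))
  where lemma : ∀ c a x u → c * a + x * (c * u) ≡ c * (a + x * u)
        lemma = solve-∀ ℚ-ring

XPolynomial : (ℕ → ℚ) → Set
XPolynomial h = Σ Poly λ Q → ∀ n → ι n * evalPoly Q (ι n) ≡ h n

XPolynomial-cong : ∀ {h h′ : ℕ → ℚ} → (∀ n → h n ≡ h′ n) → XPolynomial h → XPolynomial h′
XPolynomial-cong eq (Q , hQ) = Q , λ n → trans (hQ n) (eq n)

XPolynomial-0 : XPolynomial (λ _ → 0ℚ)
XPolynomial-0 = [] , λ n → ℚₚ.*-zeroʳ (ι n)

XPolynomial-+ : ∀ {h h′ : ℕ → ℚ} → XPolynomial h → XPolynomial h′ → XPolynomial (λ n → h n + h′ n)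
XPolynomial-+ (Q , hQ) (Q′ , hQ′) = Q +ₚ Q′ , λ n →
  trans (cong (ι n *_) (evalPoly-+ₚ Q Q′ (ι n)))
        (trans (ℚₚ.*-distribˡ-+ (ι n) _ _) (cong₂ _+_ (hQ n) (hQ′ n)))

XPolynomial-* : ∀ {h : ℕ → ℚ} c → XPolynomial h → XPolynomial (λ n → c * h n)
XPolynomial-* c (Q , hQ) = c *ₚ Q , λ n →
  trans (cong (ι n *_) (evalPoly-*ₚ c Q (ι n)))
        (trans (ℚₚ.*-comm (ι n) (c * _)) (trans (ℚₚ.*-assoc c _ (ι n))
        (cong (c *_) (trans (ℚₚ.*-comm _ (ι n)) (hQ n)))))

XPolynomial-ι* : ∀ {h : ℕ → ℚ} → XPolynomial h → XPolynomial (λ n → ι n * h n)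
XPolynomial-ι* (Q , hQ) = X* Q , λ n → cong (ι n *_) (trans (ℚₚ.+-identityˡ _) (hQ n))

XPolynomial-binomial : ∀ k → XPolynomial (λ n → ι (n C suc k))
XPolynomial-binomial zero    = 1ℚ ∷ [] , λ n → trans (lemma (ι n)) (cong ι (sym (nC1≡n n)))
  where lemma : ∀ x → x * (1ℚ + x * 0ℚ) ≡ x
        lemma = solve-∀ ℚ-ring
XPolynomial-binomial (suc k) =
  XPolynomial-cong step
    (XPolynomial-* r (XPolynomial-+ (XPolynomial-ι* (XPolynomial-binomial k))
                                    (XPolynomial-* (- ι (suc k)) (XPolynomial-binomial k))))
  where
  r = recipℤ (+ suc (suc k))
  step : ∀ n → r * (ι n * ι (n C suc k) + - ι (suc k) * ι (n C suc k)) ≡ ι (n C suc (suc k))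
  step n = begin
    r * (ι n * X + - ι (suc k) * X)    ≡⟨ cong (r *_) (isolate (ι (suc k)) (ι n) X _ (sym (ι-n*nCk n (suc k)))) ⟨
    r * (ι (suc (suc k)) * Y)          ≡⟨ recipℤ-suc-*-ι-suc (suc k) Y ⟩
    Y                                  ∎
    where
    X = ι (n C suc k)
    Y = ι (n C suc (suc k))
    isolate : ∀ x y c b → x * c + b ≡ y * c → b ≡ y * c + - x * c
    isolate x y c b eq = trans (lemma x c b) (cong (_+ - x * c) eq)
      where lemma : ∀ x c b → b ≡ (x * c + b) + - x * c
            lemma = solve-∀ ℚ-ring

module WeightedSums
  (G H : ℕ → ℕ → ℚ)
  (G-recˡ : ∀ a m → ι (suc a) * G (suc a) m ≡ ι (suc a) * G a m - H a m)
  (G-recʳ : ∀ a m → ι (suc m) * G a (suc m) ≡ ι (suc m) * G a m + H a m)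
  where

  module _ (j : ℕ) where

    private
      φ : ℕ → ℕ → ℚ
      φ a m = ι (a C j) * G a m

      V : ℕ → ℚ
      V n = antidiagSum n φ

      local-step : ∀ a m → ι (suc a) * φ (suc a) m + ι (suc m) * φ a (suc m)
                           ≡ ι j * φ (suc a) m + ι (suc (suc (a ℕ.+ m))) * φ a m
      local-step a m = begin
        ι (suc a) * (c′ * G (suc a) m) + ι (suc m) * (c * G a (suc m))
          ≡⟨ lemma₁ (ι (suc a)) c′ (G (suc a) m) (ι (suc m)) c (G a (suc m)) ⟩
        (ι (suc a) * c′) * G (suc a) m + c * (ι (suc m) * G a (suc m))
          ≡⟨ cong₂ (λ u v → u * G (suc a) m + c * v) (ι-[n+1]*[n+1]Ck a j) (G-recʳ a m) ⟩
        (ι j * c′ + ι (suc a) * c) * G (suc a) m + c * (ι (suc m) * G a m + H a m)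
          ≡⟨ lemma₂ (ι j) c′ (ι (suc a)) c (G (suc a) m) _ ⟩
        ι j * (c′ * G (suc a) m) + c * (ι (suc a) * G (suc a) m) + c * (ι (suc m) * G a m + H a m)
          ≡⟨ cong (λ u → ι j * (c′ * G (suc a) m) + c * u + c * (ι (suc m) * G a m + H a m)) (G-recˡ a m) ⟩
        ι j * (c′ * G (suc a) m) + c * (ι (suc a) * G a m - H a m) + c * (ι (suc m) * G a m + H a m)
          ≡⟨ lemma₃ (ι j) (c′ * G (suc a) m) c (ι (suc a)) (ι (suc m)) (G a m) (H a m) ⟩
        ι j * φ (suc a) m + (ι (suc a) + ι (suc m)) * φ a m
          ≡⟨ cong (λ u → ι j * φ (suc a) m + u * φ a m) (sym (ι-homo-+ (suc a) (suc m))) ⟩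
        ι j * φ (suc a) m + ι (suc a ℕ.+ suc m) * φ a m
          ≡⟨ cong (λ s → ι j * φ (suc a) m + ι (suc s) * φ a m) (ℕₚ.+-suc a m) ⟩
        ι j * φ (suc a) m + ι (suc (suc (a ℕ.+ m))) * φ a m ∎
        where
        c  = ι (a C j)
        c′ = ι (suc a C j)
        lemma₁ : ∀ i c′ g i′ c g′ → i * (c′ * g) + i′ * (c * g′) ≡ (i * c′) * g + c * (i′ * g′)
        lemma₁ = solve-∀ ℚ-ring
        lemma₂ : ∀ x c′ i c g y → (x * c′ + i * c) * g + y ≡ x * (c′ * g) + c * (i * g) + y
        lemma₂ = solve-∀ ℚ-ring
        lemma₃ : ∀ x y c i i′ g h → x * y + c * (i * g - h) + c * (i′ * g + h) ≡ x * y + (i + i′) * (c * g)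
        lemma₃ = solve-∀ ℚ-ring

      drop-zero-termˡ : ∀ x y → 0ℚ * x + y ≡ y
      drop-zero-termˡ x y = trans (cong (_+ y) (ℚₚ.*-zeroˡ x)) (ℚₚ.+-identityˡ y)

      drop-zero-termʳ : ∀ x y → y + 0ℚ * x ≡ y
      drop-zero-termʳ x y = trans (cong (_+_ y) (ℚₚ.*-zeroˡ x)) (ℚₚ.+-identityʳ y)

      -- Write n + 1 = a + m on the antidiagonal: the two halves shift to the antidiagonal of n,
      -- where the recurrences for G apply in the form of local-step.
      V-step : ∀ n → ι (suc n) * V (suc n) ≡ ι j * V (suc n) + ι (suc (suc n)) * V n
      V-step n = begin
        ι (suc n) * V (suc n)
          ≡⟨ antidiagSum-weight (suc n) ι φ ⟨
        antidiagSum (suc n) (λ a m → ι (a ℕ.+ m) * φ a m)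
          ≡⟨ antidiagSum-cong (suc n) split ⟩
        antidiagSum (suc n) (λ a m → ι a * φ a m + ι m * φ a m)
          ≡⟨ antidiagSum-+ (suc n) (λ a m → ι a * φ a m) (λ a m → ι m * φ a m) ⟩
        antidiagSum (suc n) (λ a m → ι a * φ a m) + antidiagSum (suc n) (λ a m → ι m * φ a m)
          ≡⟨ cong₂ _+_ (drop-zero-termˡ (φ 0 (suc n)) (antidiagSum n (λ a m → ι (suc a) * φ (suc a) m)))
                       (trans (antidiagSum-last n (λ a m → ι m * φ a m))
                              (drop-zero-termʳ (φ (suc n) 0) (antidiagSum n (λ a m → ι (suc m) * φ a (suc m))))) ⟩
        antidiagSum n (λ a m → ι (suc a) * φ (suc a) m) + antidiagSum n (λ a m → ι (suc m) * φ a (suc m))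
          ≡⟨ antidiagSum-+ n (λ a m → ι (suc a) * φ (suc a) m) (λ a m → ι (suc m) * φ a (suc m)) ⟨
        antidiagSum n (λ a m → ι (suc a) * φ (suc a) m + ι (suc m) * φ a (suc m))
          ≡⟨ antidiagSum-cong n local-step ⟩
        antidiagSum n (λ a m → ι j * φ (suc a) m + ι (suc (suc (a ℕ.+ m))) * φ a m)
          ≡⟨ antidiagSum-+ n (λ a m → ι j * φ (suc a) m) (λ a m → ι (suc (suc (a ℕ.+ m))) * φ a m) ⟩
        antidiagSum n (λ a m → ι j * φ (suc a) m) + antidiagSum n (λ a m → ι (suc (suc (a ℕ.+ m))) * φ a m)
          ≡⟨ cong₂ _+_ (antidiagSum-weight n (λ _ → ι j) (λ a m → φ (suc a) m))
                       (antidiagSum-weight n (λ s → ι (suc (suc s))) φ) ⟩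
        ι j * antidiagSum n (λ a m → φ (suc a) m) + ι (suc (suc n)) * V n
          ≡⟨ cong (_+ ι (suc (suc n)) * V n) ι-j*V ⟨
        ι j * V (suc n) + ι (suc (suc n)) * V n ∎
        where
        split : ∀ a m → ι (a ℕ.+ m) * φ a m ≡ ι a * φ a m + ι m * φ a m
        split a m = trans (cong (_* φ a m) (ι-homo-+ a m)) (ℚₚ.*-distribʳ-+ (φ a m) (ι a) (ι m))
        ι-j*V : ι j * V (suc n) ≡ ι j * antidiagSum n (λ a m → φ (suc a) m)
        ι-j*V = begin
          ι j * (ι (0 C j) * G 0 (suc n) + antidiagSum n (λ a m → φ (suc a) m))
            ≡⟨ lemma (ι j) (ι (0 C j)) (G 0 (suc n)) _ ⟩
          (ι j * ι (0 C j)) * G 0 (suc n) + ι j * antidiagSum n (λ a m → φ (suc a) m)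
            ≡⟨ cong (λ u → u * G 0 (suc n) + ι j * antidiagSum n (λ a m → φ (suc a) m))
                    (trans (sym (ι-homo-* j (0 C j))) (cong ι (k*0Ck≡0 j))) ⟩
          0ℚ * G 0 (suc n) + ι j * antidiagSum n (λ a m → φ (suc a) m)
            ≡⟨ drop-zero-termˡ (G 0 (suc n)) _ ⟩
          ι j * antidiagSum n (λ a m → φ (suc a) m) ∎
          where lemma : ∀ x c g s → x * (c * g + s) ≡ (x * c) * g + x * s
                lemma = solve-∀ ℚ-ring

      φ-vanishes : ∀ a m → a < j → φ a m ≡ 0ℚ
      φ-vanishes a m a<j = trans (cong (λ c → ι c * G a m) (k>n⇒nCk≡0 a<j)) (ℚₚ.*-zeroˡ (G a m))

      V-below : ∀ n → n < j → V n ≡ 0ℚ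
      V-below n n<j = antidiagSum-vanishes n (λ a m a+m≡n →
        φ-vanishes a m (ℕₚ.≤-<-trans (subst (a ℕ.≤_) a+m≡n (ℕₚ.m≤m+n a m)) n<j))

      V-from-diagonal : ∀ d → V (d ℕ.+ j) ≡ G j 0 * ι (suc (d ℕ.+ j) C suc j)
      V-from-diagonal zero = begin
        V j                            ≡⟨ antidiagSum-diagonal j φ φ-vanishes ⟩
        ι (j C j) * G j 0              ≡⟨ cong (λ c → ι c * G j 0) (nCn≡1 j) ⟩
        1ℚ * G j 0                     ≡⟨ ℚₚ.*-comm 1ℚ (G j 0) ⟩
        G j 0 * 1ℚ                     ≡⟨ cong (λ c → G j 0 * ι c) (nCn≡1 (suc j)) ⟨
        G j 0 * ι (suc j C suc j)      ∎
      V-from-diagonal (suc d) = ι-suc-*-injective d (begin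
        ι (suc d) * V (suc n)
          ≡⟨ [x+y]*c≡y*c+w⇒x*c≡w (ι (suc d)) (ι j) _ _
               (trans (cong (_* V (suc n)) (sym (ι-homo-+ (suc d) j))) (V-step n)) ⟩
        ι (suc (suc n)) * V n
          ≡⟨ cong (ι (suc (suc n)) *_) (V-from-diagonal d) ⟩
        ι (suc (suc n)) * (G j 0 * ι (suc n C suc j))
          ≡⟨ lemma (ι (suc (suc n))) (G j 0) _ ⟩
        G j 0 * (ι (suc (suc n)) * ι (suc n C suc j))
          ≡⟨ cong (G j 0 *_) binomial-step ⟨
        G j 0 * (ι (suc d) * ι (suc (suc n) C suc j))
          ≡⟨ lemma (G j 0) (ι (suc d)) _ ⟩
        ι (suc d) * (G j 0 * ι (suc (suc n) C suc j)) ∎)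
        where
        n = d ℕ.+ j
        lemma : ∀ x y z → x * (y * z) ≡ y * (x * z)
        lemma = solve-∀ ℚ-ring
        ι-split : ι (suc (suc n)) ≡ ι (suc d) + ι (suc j)
        ι-split = trans (cong (λ s → ι (suc s)) (sym (ℕₚ.+-suc d j))) (ι-homo-+ (suc d) (suc j))
        binomial-step : ι (suc d) * ι (suc (suc n) C suc j) ≡ ι (suc (suc n)) * ι (suc n C suc j)
        binomial-step = [x+y]*c≡y*c+w⇒x*c≡w (ι (suc d)) (ι (suc j)) _ _
          (trans (cong (_* ι (suc (suc n) C suc j)) (sym ι-split)) (ι-[n+1]*[n+1]Ck (suc n) (suc j)))

    binomial-antidiagSum : ∀ n → antidiagSum n (λ a m → ι (a C j) * G a m) ≡ G j 0 * ι (suc n C suc j)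
    binomial-antidiagSum n with ℕₚ.<-≤-connex n j
    ... | inj₁ n<j = trans (V-below n n<j) (sym (trans (cong (λ c → G j 0 * ι c) (k>n⇒nCk≡0 (s≤s n<j)))
                                                      (ℚₚ.*-zeroʳ (G j 0))))
    ... | inj₂ j≤n =
      subst (λ n → V n ≡ G j 0 * ι (suc n C suc j)) (ℕₚ.m∸n+n≡m j≤n) (V-from-diagonal (n ∸ j))

  -- Opaque so that the weight g can be inferred from XPolynomial (weightedSum g).
  opaque
    weightedSum : (ℕ → ℚ) → ℕ → ℚ
    weightedSum g n = ∑[ a < n ] (g a * G a (n ∸ 1 ∸ a))

  opaque
    unfolding weightedSum

    weightedSum-cong : ∀ {g g′ : ℕ → ℚ} → (∀ a → g a ≡ g′ a) →
                       ∀ n → weightedSum g n ≡ weightedSum g′ n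
    weightedSum-cong eq n = ∑-cong n (λ a → cong (_* G a (n ∸ 1 ∸ a)) (eq a))

    weightedSum-zero : ∀ {g : ℕ → ℚ} → (∀ a → g a ≡ 0ℚ) → ∀ n → weightedSum g n ≡ 0ℚ
    weightedSum-zero eq n =
      ∑-zero n (λ a → trans (cong (_* G a (n ∸ 1 ∸ a)) (eq a)) (ℚₚ.*-zeroˡ (G a (n ∸ 1 ∸ a))))

    weightedSum-+ : ∀ g h n → weightedSum (λ a → g a + h a) n ≡ weightedSum g n + weightedSum h n
    weightedSum-+ g h n = trans (∑-cong n (λ a → ℚₚ.*-distribʳ-+ _ (g a) (h a))) (∑-+ n _ _)

    weightedSum-* : ∀ c g n → weightedSum (λ a → c * g a) n ≡ c * weightedSum g n
    weightedSum-* c g n = trans (∑-cong n (λ a → ℚₚ.*-assoc c (g a) _)) (∑-*ˡ n c _)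

    Σℚ-map-upTo-weightedSum : ∀ g n → Σℚ (map (λ a → g a * G a (n ∸ 1 ∸ a)) (upTo n)) ≡ weightedSum g n
    Σℚ-map-upTo-weightedSum g n = Σℚ-map-upTo (λ a → g a * G a (n ∸ 1 ∸ a)) n

    weightedSum-binomial : ∀ j n → weightedSum (λ a → ι (a C j)) n ≡ G j 0 * ι (n C suc j)
    weightedSum-binomial j zero    = sym (ℚₚ.*-zeroʳ (G j 0))
    weightedSum-binomial j (suc n) =
      trans (∑-antidiagSum n (λ a m → ι (a C j) * G a m)) (binomial-antidiagSum j n)

  XPolynomial-weightedSum-cong : ∀ {g g′ : ℕ → ℚ} → (∀ a → g a ≡ g′ a) →
                                 XPolynomial (weightedSum g) → XPolynomial (weightedSum g′)
  XPolynomial-weightedSum-cong eq = XPolynomial-cong (weightedSum-cong eq)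

  XPolynomial-weightedSum-+ : ∀ {g h : ℕ → ℚ} → XPolynomial (weightedSum g) → XPolynomial (weightedSum h) →
                              XPolynomial (weightedSum (λ a → g a + h a))
  XPolynomial-weightedSum-+ {g} {h} Pg Ph =
    XPolynomial-cong (λ n → sym (weightedSum-+ g h n)) (XPolynomial-+ Pg Ph)

  XPolynomial-weightedSum-* : ∀ {g : ℕ → ℚ} c → XPolynomial (weightedSum g) →
                              XPolynomial (weightedSum (λ a → c * g a))
  XPolynomial-weightedSum-* {g} c Pg =
    XPolynomial-cong (λ n → sym (weightedSum-* c g n)) (XPolynomial-* c Pg)

  XPolynomial-weightedSum-binomial*poly :
    ∀ q j → XPolynomial (weightedSum (λ a → ι (a C j) * evalPoly q (ι a)))
  XPolynomial-weightedSum-binomial*poly [] j =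
    XPolynomial-cong (λ n → sym (weightedSum-zero (λ a → ℚₚ.*-zeroʳ (ι (a C j))) n)) XPolynomial-0
  XPolynomial-weightedSum-binomial*poly (q₀ ∷ q) j =
    XPolynomial-weightedSum-cong expand
      (XPolynomial-weightedSum-+
        (XPolynomial-weightedSum-+
          (XPolynomial-weightedSum-* q₀ binomial)
          (XPolynomial-weightedSum-* (ι j) (XPolynomial-weightedSum-binomial*poly q j)))
        (XPolynomial-weightedSum-* (ι (suc j)) (XPolynomial-weightedSum-binomial*poly q (suc j))))
    where
    binomial : XPolynomial (weightedSum (λ a → ι (a C j)))
    binomial = XPolynomial-cong (λ n → sym (weightedSum-binomial j n)) (XPolynomial-* (G j 0) (XPolynomial-binomial j))
    expand : ∀ a → q₀ * ι (a C j) + ι j * (ι (a C j) * evalPoly q (ι a))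
                     + ι (suc j) * (ι (a C suc j) * evalPoly q (ι a))
                   ≡ ι (a C j) * (q₀ + ι a * evalPoly q (ι a))
    expand a = begin
      q₀ * c + ι j * (c * Q) + ι (suc j) * (c′ * Q)   ≡⟨ lemma₁ q₀ c (ι j) (ι (suc j)) c′ Q ⟩
      q₀ * c + (ι j * c + ι (suc j) * c′) * Q         ≡⟨ cong (λ u → q₀ * c + u * Q) (ι-n*nCk a j) ⟨
      q₀ * c + (ι a * c) * Q                          ≡⟨ lemma₂ q₀ c (ι a) Q ⟩
      c * (q₀ + ι a * Q)                              ∎
      where
      c  = ι (a C j)
      c′ = ι (a C suc j)
      Q  = evalPoly q (ι a)
      lemma₁ : ∀ q₀ c x y c′ Q → q₀ * c + x * (c * Q) + y * (c′ * Q) ≡ q₀ * c + (x * c + y * c′) * Q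
      lemma₁ = solve-∀ ℚ-ring
      lemma₂ : ∀ q₀ c x Q → q₀ * c + (x * c) * Q ≡ c * (q₀ + x * Q)
      lemma₂ = solve-∀ ℚ-ring

  XPolynomial-weightedSum-poly : ∀ p → XPolynomial (weightedSum (λ a → evalPoly p (ι a)))
  XPolynomial-weightedSum-poly p =
    XPolynomial-weightedSum-cong (λ a → ℚₚ.*-identityˡ _) (XPolynomial-weightedSum-binomial*poly p 0)

  XPolynomial-weightedSum-poly2 : ∀ f → XPolynomial (λ n → weightedSum (λ a → evalPoly2 f (ι n) (ι a)) n)
  XPolynomial-weightedSum-poly2 [] =
    XPolynomial-cong (λ n → sym (weightedSum-zero (λ a → refl) n)) XPolynomial-0
  XPolynomial-weightedSum-poly2 (p ∷ f) =
    XPolynomial-cong expand (XPolynomial-+ (XPolynomial-weightedSum-poly p)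
                                            (XPolynomial-ι* (XPolynomial-weightedSum-poly2 f)))
    where
    expand : ∀ n → weightedSum (λ a → evalPoly p (ι a)) n
                     + ι n * weightedSum (λ a → evalPoly2 f (ι n) (ι a)) n
                   ≡ weightedSum (λ a → evalPoly p (ι a) + ι n * evalPoly2 f (ι n) (ι a)) n
    expand n = sym (begin
      weightedSum (λ a → evalPoly p (ι a) + ι n * evalPoly2 f (ι n) (ι a)) n
        ≡⟨ weightedSum-+ (λ a → evalPoly p (ι a)) (λ a → ι n * evalPoly2 f (ι n) (ι a)) n ⟩
      weightedSum (λ a → evalPoly p (ι a)) n + weightedSum (λ a → ι n * evalPoly2 f (ι n) (ι a)) n
        ≡⟨ cong (_+_ (weightedSum (λ a → evalPoly p (ι a)) n))
                (weightedSum-* (ι n) (λ a → evalPoly2 f (ι n) (ι a)) n) ⟩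
      weightedSum (λ a → evalPoly p (ι a)) n + ι n * weightedSum (λ a → evalPoly2 f (ι n) (ι a)) n ∎)

lemma5p14 : (f : Poly2) → (k : ℕ) → 1 < k →
    Σ Poly (λ P → XDivides P × ((n : ℕ) → 1 ≤ n → evalPoly P (ℕ→ℚ n) ≡ rhs f k n))
lemma5p14 f (suc (suc r)) (s≤s (s≤s _)) =
  let (Q , Q-spec) = XPolynomial-weightedSum-poly2 f in
  X* Q , (Q , refl) , λ n _ → begin
    evalPoly (X* Q) (ι n)                            ≡⟨ ℚₚ.+-identityˡ _ ⟩
    ι n * evalPoly Q (ι n)                           ≡⟨ Q-spec n ⟩
    weightedSum (λ a → evalPoly2 f (ι n) (ι a)) n    ≡⟨ rhs≡weightedSum n ⟨
    rhs f (suc (suc r)) n                            ∎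
  where
  open WeightedSums (λ a m → esymRecip (suc r) (window a m)) (λ a m → esymRecip r (window a m))
                    (esymRecip-window-sucˡ r) (esymRecip-window-sucʳ r)
  rhs≡weightedSum : ∀ n → rhs f (suc (suc r)) n ≡ weightedSum (λ a → evalPoly2 f (ι n) (ι a)) n
  rhs≡weightedSum n = trans
    (cong Σℚ (Listₚ.map-cong (λ a → cong (evalPoly2 f (ι n) (ι a) *_) (innerSum≡esymRecip-window (suc r) n a))
                             (upTo n)))
    (Σℚ-map-upTo-weightedSum (λ a → evalPoly2 f (ι n) (ι a)) n)
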